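{- Let $(M,G,V,\mathcal{E})$ be a homogeneous factorisation of $K_n=(V,E)$ of index $k$ with factors $\Gamma_1,\dots,\Gamma_k$ (so $\mathcal{E}=\{E\Gamma_1,\dots,E\Gamma_k\}$), such that $M$ is edge-transitive on each factor. Suppose $G=T\rtimes G_0$ is an affine $2$-homogeneous permutation group on $V=V(a,q)$. Then: (1) each factor is a Cayley graph $\Gamma_i=\mathrm{Cay}(V,S_i)$ with $S_i=-S_i$ and $E\Gamma_i=\{\{u,v\}: v-u\in S_i\}$, and $\{S_1,\dots,S_k\}$ is a partition of $V\setminus\{\mathbf{0}\}$; (2) $G_0$ acts transitively on $\{S_1,\dots,S_k\}$.
   Context: A homogeneous factorisation of index $k>1$ of $K_n=(V,E)$ ($E$ the 2-subsets of $V$) is a 4-tuple $(M,G,V,\mathcal{E})$ where $\mathcal{E}$ partitions $E$ into $k$ parts, $G\le\mathrm{Sym}(V)$ is transitive on $V$, leaves $\mathcal{E}$ invariant and permutes its parts transitively, and the kernel $M$ of this action is transitive on $V$. Here $V=V(a,q)=\mathbb{F}_q^a$, $T$ is the group of translations $v\mapsto v+x$ ($x\in V$), and $G_0\le\Gamma L(a,q)$ is the stabiliser of $\mathbf{0}$; $2$-homogeneous means transitive on 2-subsets of $V$. -}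

module Defs where

open import Data.Nat using (ℕ; _<_)
open import Data.Fin using (Fin)
open import Data.Vec using (Vec; map; zipWith; replicate)
open import Data.Product using (Σ; ∃; ∃₂; _×_; _,_)
open import Data.Sum using (_⊎_)
open import Relation.Binary.PropositionalEquality using (_≡_; _≢_)
open import Relation.Nullary using (¬_)
open import Algebra.Structures using (IsCommutativeRing)
open import Function.Bundles using (_↔_; _⇔_)

record FiniteField : Set₁ where
  field
    Carrier : Set
    _+_ _*_ : Carrier → Carrier → Carrier
    -_ : Carrier → Carrier
    0# 1# : Carrier
    isCommutativeRing : IsCommutativeRing _≡_ _+_ _*_ -_ 0# 1#
    0≢1 : 0# ≢ 1#
    inverse : ∀ x → x ≢ 0# → ∃ λ y → x * y ≡ 1#
    size : ℕ
    enum : Carrier ↔ Fin size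

IsBij : {X : Set} → (X → X) → Set
IsBij {X} f = (∀ x y → f x ≡ f y → x ≡ y) × (∀ y → ∃ λ x → f x ≡ y)

record IsPermGroup {X : Set} (G : (X → X) → Set) : Set₁ where
  field
    bij    : ∀ g → G g → IsBij g
    ext    : ∀ g h → (∀ x → g x ≡ h x) → G g → G h
    idᴳ    : G (λ x → x)
    comp   : ∀ g h → G g → G h → G (λ x → g (h x))
    invᴳ   : ∀ g → G g → ∃ λ h → G h × (∀ x → h (g x) ≡ x) × (∀ x → g (h x) ≡ x)

MapsPair : {X : Set} → (X → X) → X → X → X → X → Set
MapsPair g u v u' v' = (g u ≡ u' × g v ≡ v') ⊎ (g u ≡ v' × g v ≡ u')

Transitive : {X : Set} → ((X → X) → Set) → Set
Transitive {X} G = ∀ (u v : X) → ∃ λ g → G g × g u ≡ v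

TwoHomogeneous : {X : Set} → ((X → X) → Set) → Set
TwoHomogeneous {X} G = ∀ (u v u' v' : X) → u ≢ v → u' ≢ v' →
  ∃ λ g → G g × MapsPair g u v u' v'

-- The partition 𝓔 of E (2-subsets of X) into k parts is given by a
-- labelling  part : X → X → Fin k  (only its values on u ≢ v matter);
-- part i consists of the edges {u,v} with u ≢ v and part u v ≡ i.

module Factorisation {X : Set} (k : ℕ) (part : X → X → Fin k) where

  InPart : Fin k → X → X → Set
  InPart i u v = u ≢ v × part u v ≡ i

  MapsPart : (X → X) → Fin k → Fin k → Set
  MapsPart g i j = ∀ u v → InPart i u v ⇔ InPart j (g u) (g v)

  Kernel : ((X → X) → Set) → (X → X) → Set
  Kernel G g = G g × (∀ i → MapsPart g i i)

  record IsHomogeneousFactorisation (G : (X → X) → Set) : Set₁ where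
    field
      index>1      : 1 < k
      symmetric    : ∀ u v → u ≢ v → part u v ≡ part v u
      nonempty     : ∀ i → ∃₂ λ u v → InPart i u v
      permGroup    : IsPermGroup G
      G-transitive : Transitive G
      invariant    : ∀ g → G g → ∀ i → ∃ λ j → MapsPart g i j
      transOnParts : ∀ i j → ∃ λ g → G g × MapsPart g i j
      M-transitive : Transitive (Kernel G)

  KernelEdgeTransitive : ((X → X) → Set) → Set
  KernelEdgeTransitive G = ∀ i u v u' v' → InPart i u v → InPart i u' v' →
    ∃ λ m → Kernel G m × MapsPair m u v u' v'

module Affine (F : FiniteField) (a : ℕ) where
  open FiniteField F

  V : Set
  V = Vec Carrier a

  𝟎 : V
  𝟎 = replicate a 0#

  _⊕_ : V → V → V
  _⊕_ = zipWith _+_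

  ⊖_ : V → V
  ⊖_ = map -_

  _·_ : Carrier → V → V
  c · v = map (c *_) v

  τ : V → V → V
  τ x v = v ⊕ x

  IsFieldAut : (Carrier → Carrier) → Set
  IsFieldAut σ = (∀ x y → σ (x + y) ≡ σ x + σ y)
               × (∀ x y → σ (x * y) ≡ σ x * σ y)
               × σ 1# ≡ 1#
               × IsBij σ

  InΓL : (V → V) → Set
  InΓL g = IsBij g × ∃ λ σ → IsFieldAut σ
         × (∀ u v → g (u ⊕ v) ≡ g u ⊕ g v)
         × (∀ c v → g (c · v) ≡ σ c · g v)

  record IsAffine2Homogeneous (G : (V → V) → Set) : Set₁ where
    field
      permGroup      : IsPermGroup G
      translations   : ∀ x → G (τ x)
      stabiliserInΓL : ∀ g → G g → g 𝟎 ≡ 𝟎 → InΓL g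
      twoHomogeneous : TwoHomogeneous G

module Submission where

-- Call d a period of the labelling if translation by d preserves it. Periods are closed
-- under negation and under the linear parts of elements of G, and since G_0 is transitive
-- on nonzero vectors up to sign (2-homogeneity), one nonzero period makes every vector a
-- period. Given w ≠ 𝟎, take m ∈ M with m 𝟎 = w: on a pair {u,v}, either m has a nonzero
-- commutator with a translation, or it acts as the translation by w and so fixes the
-- label. Hence T ≤ M, each part consists of the pairs whose difference lies in
-- S_i = {x : {𝟎,x} ∈ part i}, and g ∈ G carries S_i onto S_j through its linear part.

open import Defs
open import Algebra.Bundles using (AbelianGroup)
open import Algebra.Structures using (IsAbelianGroup; IsCommutativeRing)
import Algebra.Properties.CommutativeSemigroup as CommutativeSemigroupProperties
import Algebra.Properties.Group as GroupProperties
open import Data.Fin as Fin using (Fin)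
open import Data.Nat using (ℕ)
open import Data.Product using (Σ; ∃; ∃!; _×_; _,_; proj₂)
open import Data.Sum using (inj₁; inj₂)
open import Data.Vec.Properties
  using (zipWith-assoc; zipWith-identityˡ; zipWith-identityʳ; zipWith-inverseˡ; zipWith-inverseʳ; zipWith-comm; ≡-dec)
open import Function.Base using (_∘_)
open import Function.Bundles using (_⇔_; Equivalence; mk⇔)
open import Function.Properties.Inverse using (↔⇒↣)
open import Level using (0ℓ)
open import Relation.Binary.Definitions using (DecidableEquality)
open import Relation.Binary.PropositionalEquality
  using (_≡_; _≢_; refl; sym; trans; cong; cong₂; subst; subst₂; isEquivalence; module ≡-Reasoning)
open import Relation.Nullary using (¬_; yes; no)
open import Relation.Nullary.Decidable using (via-injection)

open Equivalence using (to; from)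

module VectorSpace (F : FiniteField) (a : ℕ) where
  open FiniteField F using (isCommutativeRing; enum)
  open IsCommutativeRing isCommutativeRing
    using (+-assoc; +-identityˡ; +-identityʳ; -‿inverseˡ; -‿inverseʳ; +-comm)
  open Affine F a

  ⊕-isAbelianGroup : IsAbelianGroup _≡_ _⊕_ 𝟎 ⊖_
  ⊕-isAbelianGroup = record
    { isGroup = record
      { isMonoid = record
        { isSemigroup = record
          { isMagma = record { isEquivalence = isEquivalence ; ∙-cong = cong₂ _⊕_ }
          ; assoc = zipWith-assoc +-assoc
          }
        ; identity = zipWith-identityˡ +-identityˡ , zipWith-identityʳ +-identityʳ
        }
      ; inverse = zipWith-inverseˡ -‿inverseˡ , zipWith-inverseʳ -‿inverseʳ
      ; ⁻¹-cong = cong ⊖_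
      }
    ; comm = zipWith-comm +-comm
    }

  ⊕-abelianGroup : AbelianGroup 0ℓ 0ℓ
  ⊕-abelianGroup = record { isAbelianGroup = ⊕-isAbelianGroup }

  open AbelianGroup ⊕-abelianGroup public
    using (identityˡ; identityʳ; inverseʳ; assoc)
  open GroupProperties (AbelianGroup.group ⊕-abelianGroup) public
    using (//-rightDividesˡ; //-rightDividesʳ; ∙-cancelʳ; ε⁻¹≈ε; ⁻¹-involutive; x∙y⁻¹≈ε⇒x≈y)
  open CommutativeSemigroupProperties (AbelianGroup.commutativeSemigroup ⊕-abelianGroup) public
    using (xy∙z≈xz∙y)

  infix 4 _≟_
  _≟_ : DecidableEquality V
  _≟_ = ≡-dec (via-injection (↔⇒↣ enum) Fin._≟_)

  _⊖_ : V → V → V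
  x ⊖ y = x ⊕ (⊖ y)

  ⊕-preserves-≢ : ∀ {u v} d → u ≢ v → u ⊕ d ≢ v ⊕ d
  ⊕-preserves-≢ {u} {v} d u≢v = u≢v ∘ ∙-cancelʳ d u v

module _ {X : Set} {k : ℕ} {part : X → X → Fin k} where
  open Factorisation k part

  samePart-image : ∀ {G} → IsHomogeneousFactorisation G → ∀ {g i u v x y} → G g →
                   InPart i u v → InPart i x y → part (g u) (g v) ≡ part (g x) (g y)
  samePart-image HF {g} {i} g∈G uv xy with IsHomogeneousFactorisation.invariant HF g g∈G i
  ... | _ , g[i]≡j = trans (proj₂ (to (g[i]≡j _ _) uv)) (sym (proj₂ (to (g[i]≡j _ _) xy)))

  part-preserved : ∀ {m u v} → (∀ i → MapsPart m i i) → u ≢ v → part (m u) (m v) ≡ part u v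
  part-preserved {m} {u} {v} m-fixesParts u≢v = proj₂ (to (m-fixesParts (part u v) u v) (u≢v , refl))

module AffineMaps (F : FiniteField) (a : ℕ) {G : (Affine.V F a → Affine.V F a) → Set}
                  (HA : Affine.IsAffine2Homogeneous F a G) where
  open Affine F a
  open VectorSpace F a
  open IsAffine2Homogeneous HA using (permGroup; translations; stabiliserInΓL)

  linearPart : (V → V) → V → V
  linearPart g x = g x ⊖ g 𝟎

  linearPart-∈G : ∀ {g} → G g → G (linearPart g)
  linearPart-∈G {g} g∈G = IsPermGroup.comp permGroup (τ (⊖ g 𝟎)) g (translations (⊖ g 𝟎)) g∈G

  linearPart-additive : ∀ {g} → G g → ∀ z d →
                        linearPart g (z ⊕ d) ≡ linearPart g z ⊕ linearPart g d
  linearPart-additive {g} g∈G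
    with stabiliserInΓL (linearPart g) (linearPart-∈G g∈G) (inverseʳ (g 𝟎))
  ... | _ , _ , _ , additive , _ = additive

  affine : ∀ {g} → G g → ∀ z d → g (z ⊕ d) ≡ g z ⊕ linearPart g d
  affine {g} g∈G z d = begin
    g (z ⊕ d)
      ≡⟨ //-rightDividesˡ (g 𝟎) (g (z ⊕ d)) ⟨
    linearPart g (z ⊕ d) ⊕ g 𝟎
      ≡⟨ cong (_⊕ g 𝟎) (linearPart-additive g∈G z d) ⟩
    (linearPart g z ⊕ linearPart g d) ⊕ g 𝟎
      ≡⟨ xy∙z≈xz∙y (linearPart g z) (linearPart g d) (g 𝟎) ⟩
    (linearPart g z ⊕ g 𝟎) ⊕ linearPart g d
      ≡⟨ cong (_⊕ linearPart g d) (//-rightDividesˡ (g 𝟎) (g z)) ⟩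
    g z ⊕ linearPart g d
      ∎
    where open ≡-Reasoning

module Periods (F : FiniteField) (a k : ℕ) (part : Affine.V F a → Affine.V F a → Fin k) where
  open Affine F a
  open VectorSpace F a
  open Factorisation {V} k part

  Period : V → Set
  Period d = ∀ u v → u ≢ v → part (u ⊕ d) (v ⊕ d) ≡ part u v

  period-𝟎 : Period 𝟎
  period-𝟎 u v _ = cong₂ part (identityʳ u) (identityʳ v)

  period-⊖ : ∀ {d} → Period d → Period (⊖ d)
  period-⊖ {d} p u v u≢v = begin
    part (u ⊖ d) (v ⊖ d)                ≡⟨ p (u ⊖ d) (v ⊖ d) (⊕-preserves-≢ (⊖ d) u≢v) ⟨
    part ((u ⊖ d) ⊕ d) ((v ⊖ d) ⊕ d)    ≡⟨ cong₂ part (//-rightDividesˡ d u) (//-rightDividesˡ d v) ⟩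
    part u v                            ∎
    where open ≡-Reasoning

  inPart-translate : ∀ {d i u v} → Period d → InPart i u v → InPart i (u ⊕ d) (v ⊕ d)
  inPart-translate {d} p (u≢v , refl) = ⊕-preserves-≢ d u≢v , p _ _ u≢v

module AffineFactorisation
  (F : FiniteField) (a k : ℕ) (part : Affine.V F a → Affine.V F a → Fin k)
  (G : (Affine.V F a → Affine.V F a) → Set)
  (HF : Factorisation.IsHomogeneousFactorisation {Affine.V F a} k part G)
  (HA : Affine.IsAffine2Homogeneous F a G) where

  open Affine F a
  open VectorSpace F a
  open Factorisation {V} k part
  open IsHomogeneousFactorisation HF
  open IsAffine2Homogeneous HA using (translations; twoHomogeneous)
  open AffineMaps F a HA
  open Periods F a k part
  open ≡-Reasoning

  surjective : ∀ {g} → G g → ∀ y → ∃ λ x → g x ≡ y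
  surjective {g} g∈G = proj₂ (IsPermGroup.bij permGroup g g∈G)

  period-conj : ∀ {g d} → G g → Period d → Period (linearPart g d)
  period-conj {g} {d} g∈G p u v u≢v with surjective g∈G u | surjective g∈G v
  ... | u′ , refl | v′ , refl = begin
    part (g u′ ⊕ linearPart g d) (g v′ ⊕ linearPart g d)
      ≡⟨ cong₂ part (affine g∈G u′ d) (affine g∈G v′ d) ⟨
    part (g (u′ ⊕ d)) (g (v′ ⊕ d))
      ≡⟨ samePart-image HF g∈G (inPart-translate p u′v′) u′v′ ⟩
    part (g u′) (g v′)
      ∎
    where
    u′v′ : InPart (part u′ v′) u′ v′
    u′v′ = u≢v ∘ cong g , refl

  -- τ (⊖ y) ∘ m ∘ τ y ∘ m⁻¹ is the translation by commutator m y.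
  commutator : (V → V) → V → V
  commutator m y = linearPart m y ⊖ y

  period-commutator : ∀ {m} → Kernel G m → ∀ y → Period (commutator m y)
  period-commutator {m} (m∈G , m-fixesParts) y u v u≢v with surjective m∈G u | surjective m∈G v
  ... | u′ , refl | v′ , refl = begin
    part (m u′ ⊕ commutator m y) (m v′ ⊕ commutator m y)
      ≡⟨ cong₂ part (conjugate u′) (conjugate v′) ⟩
    part (m (u′ ⊕ y) ⊖ y) (m (v′ ⊕ y) ⊖ y)
      ≡⟨ samePart-image HF (translations (⊖ y)) m[u′v′+y] u′v′+y ⟩
    part ((u′ ⊕ y) ⊖ y) ((v′ ⊕ y) ⊖ y)
      ≡⟨ cong₂ part (//-rightDividesʳ y u′) (//-rightDividesʳ y v′) ⟩
    part u′ v′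
      ≡⟨ part-preserved m-fixesParts (u≢v ∘ cong m) ⟨
    part (m u′) (m v′)
      ∎
    where
    conjugate : ∀ z → m z ⊕ commutator m y ≡ m (z ⊕ y) ⊖ y
    conjugate z = trans (sym (assoc (m z) (linearPart m y) (⊖ y))) (cong (_⊖ y) (sym (affine m∈G z y)))
    u′v′+y : InPart (part (u′ ⊕ y) (v′ ⊕ y)) (u′ ⊕ y) (v′ ⊕ y)
    u′v′+y = ⊕-preserves-≢ y (u≢v ∘ cong m) , refl
    m[u′v′+y] : InPart (part (u′ ⊕ y) (v′ ⊕ y)) (m (u′ ⊕ y)) (m (v′ ⊕ y))
    m[u′v′+y] = to (m-fixesParts _ (u′ ⊕ y) (v′ ⊕ y)) u′v′+y

  period-spread : ∀ {e w} → Period e → e ≢ 𝟎 → w ≢ 𝟎 → Period w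
  period-spread {e} {w} p e≢𝟎 w≢𝟎 with twoHomogeneous 𝟎 e 𝟎 w (e≢𝟎 ∘ sym) (w≢𝟎 ∘ sym)
  ... | g , g∈G , inj₁ (g𝟎≡𝟎 , ge≡w) = subst Period ge⊖g𝟎≡w (period-conj g∈G p)
    where
    ge⊖g𝟎≡w : linearPart g e ≡ w
    ge⊖g𝟎≡w = begin
      g e ⊖ g 𝟎  ≡⟨ cong₂ _⊖_ ge≡w g𝟎≡𝟎 ⟩
      w ⊕ (⊖ 𝟎)  ≡⟨ cong (w ⊕_) ε⁻¹≈ε ⟩
      w ⊕ 𝟎      ≡⟨ identityʳ w ⟩
      w          ∎
  ... | g , g∈G , inj₂ (g𝟎≡w , ge≡𝟎) =
    subst Period (⁻¹-involutive w) (period-⊖ (subst Period ge⊖g𝟎≡⊖w (period-conj g∈G p)))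
    where
    ge⊖g𝟎≡⊖w : linearPart g e ≡ ⊖ w
    ge⊖g𝟎≡⊖w = trans (cong₂ _⊖_ ge≡𝟎 g𝟎≡w) (identityˡ (⊖ w))

  period : ∀ w → Period w
  period w u v u≢v with w ≟ 𝟎
  ... | yes refl = period-𝟎 u v u≢v
  ... | no w≢𝟎 with M-transitive 𝟎 w
  ... | m , m∈M , m𝟎≡w with commutator m u ≟ 𝟎 | commutator m v ≟ 𝟎
  ... | no δu≢𝟎 | _        = period-spread (period-commutator m∈M u) δu≢𝟎 w≢𝟎 u v u≢v
  ... | yes _   | no δv≢𝟎  = period-spread (period-commutator m∈M v) δv≢𝟎 w≢𝟎 u v u≢v
  ... | yes δu≡𝟎 | yes δv≡𝟎 = begin
    part (u ⊕ w) (v ⊕ w)  ≡⟨ cong₂ part (translates u δu≡𝟎) (translates v δv≡𝟎) ⟨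
    part (m u) (m v)      ≡⟨ part-preserved (proj₂ m∈M) u≢v ⟩
    part u v              ∎
    where
    translates : ∀ y → commutator m y ≡ 𝟎 → m y ≡ y ⊕ w
    translates y δ≡𝟎 = begin
      m y                  ≡⟨ //-rightDividesˡ (m 𝟎) (m y) ⟨
      linearPart m y ⊕ m 𝟎  ≡⟨ cong₂ _⊕_ (x∙y⁻¹≈ε⇒x≈y _ _ δ≡𝟎) m𝟎≡w ⟩
      y ⊕ w                ∎

  ConnectionSet : Fin k → V → Set
  ConnectionSet i x = InPart i 𝟎 x

  inPart-toOrigin : ∀ {i u v} → InPart i u v → ConnectionSet i (v ⊖ u)
  inPart-toOrigin {i} {u} {v} uv =
    subst (λ z → InPart i z (v ⊖ u)) (inverseʳ u) (inPart-translate (period (⊖ u)) uv)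

  inPart-fromOrigin : ∀ {i u v} → ConnectionSet i (v ⊖ u) → InPart i u v
  inPart-fromOrigin {i} {u} {v} s =
    subst₂ (InPart i) (identityˡ u) (//-rightDividesˡ u v) (inPart-translate (period u) s)

  part⇔connectionSet : ∀ {i u v} → u ≢ v → part u v ≡ i ⇔ ConnectionSet i (v ⊖ u)
  part⇔connectionSet u≢v = mk⇔ (λ p → inPart-toOrigin (u≢v , p)) (proj₂ ∘ inPart-fromOrigin)

  connectionSet-nonempty : ∀ i → ∃ λ x → ConnectionSet i x
  connectionSet-nonempty i with nonempty i
  ... | u , v , uv = v ⊖ u , inPart-toOrigin uv

  connectionSet-⊖ : ∀ {i x} → ConnectionSet i x → ConnectionSet i (⊖ x)
  connectionSet-⊖ {i} {x} (𝟎≢x , p) =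
    subst (ConnectionSet i) (identityˡ (⊖ x)) (inPart-toOrigin x0)
    where
    x0 : InPart i x 𝟎
    x0 = 𝟎≢x ∘ sym , trans (sym (symmetric 𝟎 x 𝟎≢x)) p

  connectionSets-transitive : ∀ i j → ∃ λ g → G g × g 𝟎 ≡ 𝟎 ×
                              (∀ x → ConnectionSet i x ⇔ ConnectionSet j (g x))
  connectionSets-transitive i j with transOnParts i j
  ... | g , g∈G , g[i]≡j =
    linearPart g , linearPart-∈G g∈G , inverseʳ (g 𝟎) ,
    λ x → mk⇔ (inPart-toOrigin ∘ to (g[i]≡j 𝟎 x)) (from (g[i]≡j 𝟎 x) ∘ inPart-fromOrigin)

lemma4p5 : (F : FiniteField) (a k : ℕ) →
    let open Affine F a in
    (part : V → V → Fin k) (G : (V → V) → Set) →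
    let open Factorisation {V} k part in
    IsHomogeneousFactorisation G →
    KernelEdgeTransitive G →
    IsAffine2Homogeneous G →
    Σ (Fin k → V → Set) λ S →
      -- (1) Γ_i = Cay(V, S_i), S_i = -S_i, EΓ_i = {{u,v} : v - u ∈ S_i}
      (∀ i x → S i x → S i (⊖ x))
      × (∀ i u v → u ≢ v → (part u v ≡ i ⇔ S i (v ⊕ (⊖ u))))
      -- {S_1,…,S_k} is a partition of V ∖ {𝟎}
      × (∀ i → ¬ S i 𝟎)
      × (∀ x → x ≢ 𝟎 → ∃! _≡_ λ i → S i x)
      × (∀ i → ∃ λ x → S i x)
      -- (2) G_0 is transitive on {S_1,…,S_k}
      × (∀ i j → ∃ λ g → G g × g 𝟎 ≡ 𝟎 × (∀ x → S i x ⇔ S j (g x)))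
lemma4p5 F a k part G HF _ HA =
  ConnectionSet ,
  (λ _ _ → connectionSet-⊖) ,
  (λ _ _ _ → part⇔connectionSet) ,
  (λ _ (𝟎≢𝟎 , _) → 𝟎≢𝟎 refl) ,
  (λ x x≢𝟎 → part 𝟎 x , (x≢𝟎 ∘ sym , refl) , proj₂) ,
  connectionSet-nonempty ,
  connectionSets-transitive
  where
  open Affine F a
  open AffineFactorisation F a k part G HF HA
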